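{- If $Q$ is a basic sequence that is $k$-convergent for some positive integer $k$, then the set of $Q$-normal numbers in $[0,1)$ is empty.
   Context: A basic sequence is a sequence $Q=\{q_n\}_{n\ge1}$ of integers with $q_n\ge 2$ for all $n$. The $Q$-Cantor series expansion of $x\in[0,1)$ is the unique expansion $x=\sum_{n\ge1}\frac{E_n}{q_1q_2\cdots q_n}$ with $E_n\in\{0,1,\dots,q_n-1\}$ and $E_n\neq q_n-1$ for infinitely many $n$. A block of length $k$ is an ordered $k$-tuple of non-negative integers. For a block $B$ of length $k$, $N_n^Q(B,x)$ is the number of $j\in\{1,\dots,n\}$ with $(E_j,\dots,E_{j+k-1})=B$, and $Q_n^{(k)}=\sum_{j=1}^n \frac{1}{q_jq_{j+1}\cdots q_{j+k-1}}$. $x$ is $Q$-normal of order $k$ if $N_n^Q(B,x)/Q_n^{(k)}\to1$ for every block $B$ of length $k$, and $Q$-normal if it is $Q$-normal of order $k$ for all $k\ge1$. $Q$ is $k$-divergent if $Q_n^{(k)}\to\infty$, and $k$-convergent otherwise. -}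

module Defs where

open import Data.Nat as ℕ using (ℕ; zero; suc; _+_; _*_; _∸_; _≤_; _<_; _≥_)
open import Data.Integer using (+_)
open import Data.Rational as ℚ using (ℚ; 0ℚ; 1ℚ; _/_; _÷_; ∣_∣; _-_; ≢-nonZero)
open import Data.Rational.Properties using () renaming (_≟_ to _≟ℚ_)
open import Data.Vec using (Vec; tabulate)
open import Data.Vec.Properties using (≡-dec)
open import Data.Fin using (Fin; toℕ)
open import Data.Product using (Σ; ∃; _×_; _,_)
open import Relation.Nullary using (¬_; yes; no)
open import Relation.Binary.PropositionalEquality using (_≡_)

-- Sequences are 0-indexed: index i : ℕ stands for the paper's index i+1.

record BasicSeq : Set where
  field
    q   : ℕ → ℕ
    q≥2 : ∀ n → 2 ≤ q n
open BasicSeq public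

-- E is the digit sequence of a Q-Cantor series expansion of some x ∈ [0,1):
-- 0 ≤ E n ≤ q n - 1 and E n ≠ q n - 1 for infinitely many n.
-- (x ↦ its digit sequence is a bijection between [0,1) and such sequences.)
IsExpansion : BasicSeq → (ℕ → ℕ) → Set
IsExpansion Q E =
  (∀ n → E n < q Q n) × (∀ m → ∃ λ n → m ≤ n × ¬ (E n ≡ q Q n ∸ 1))

-- 1/d as a rational (d = 0 never occurs below since q n ≥ 2).
inv : ℕ → ℚ
inv zero    = 0ℚ
inv (suc d) = + 1 / suc d

prodQ : BasicSeq → ℕ → ℕ → ℕ
prodQ Q zero j    = 1
prodQ Q (suc k) j = q Q j * prodQ Q k (suc j)

Qnk : BasicSeq → ℕ → ℕ → ℚ
Qnk Q k zero    = 0ℚ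
Qnk Q k (suc n) = Qnk Q k n ℚ.+ inv (prodQ Q k n)

blockAt : (ℕ → ℕ) → (k : ℕ) → ℕ → Vec ℕ k
blockAt E k j = tabulate (λ (i : Fin k) → E (j + toℕ i))

count : (E : ℕ → ℕ) → (k : ℕ) → Vec ℕ k → ℕ → ℕ
count E k B zero = 0
count E k B (suc n) with ≡-dec ℕ._≟_ (blockAt E k n) B
... | yes _ = suc (count E k B n)
... | no  _ = count E k B n

-- N_n^Q(B,x) / Q_n^{(k)}  (given an arbitrary value 0 when Q_n^{(k)} = 0,
-- which happens only for n = 0 and so does not affect limits)
ratio : BasicSeq → (ℕ → ℕ) → (k : ℕ) → Vec ℕ k → ℕ → ℚ
ratio Q E k B n with Qnk Q k n ≟ℚ 0ℚ
... | yes _ = 0ℚ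
... | no ne = (+ count E k B n / 1) ÷ Qnk Q k n
  where instance _ = ≢-nonZero ne

_⟶_ : (ℕ → ℚ) → ℚ → Set
a ⟶ L = ∀ (ε : ℚ) → 0ℚ ℚ.< ε → ∃ λ N → ∀ n → N ≤ n → ∣ a n - L ∣ ℚ.< ε

_⟶∞ : (ℕ → ℚ) → Set
a ⟶∞ = ∀ (M : ℚ) → ∃ λ N → ∀ n → N ≤ n → M ℚ.< a n

KDivergent : BasicSeq → ℕ → Set
KDivergent Q k = (λ n → Qnk Q k n) ⟶∞

KConvergent : BasicSeq → ℕ → Set
KConvergent Q k = ¬ KDivergent Q k

NormalOfOrder : BasicSeq → (ℕ → ℕ) → ℕ → Set
NormalOfOrder Q E k = ∀ (B : Vec ℕ k) → ratio Q E k B ⟶ 1ℚ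

Normal : BasicSeq → (ℕ → ℕ) → Set
Normal Q E = ∀ k → 1 ≤ k → NormalOfOrder Q E k

{-# OPTIONS --safe #-}
module Submission where

-- If x is Q-normal of order j, then for any block B of length j the count N_n(B)
-- is eventually a positive integer with N_n(B) / Q_n^{(j)} < 2, so Q_n^{(j)} > 1/2.
-- Since every q_i ≥ 2, Q_n^{(k)} ≥ 2^s · Q_n^{(s+k)} ≥ 2^{s+1} · Q_n^{(s+k+1)}, so
-- normality of order s+k+1 forces Q_n^{(k)} > 2^s eventually; as s is arbitrary,
-- Q is k-divergent.

open import Defs
open import Data.Nat as ℕ using (ℕ; zero; suc; _+_; _*_; _^_; _≤_; _<_; z≤n; s≤s)
import Data.Nat.Properties as ℕ
open import Algebra.Properties.CommutativeSemigroup ℕ.*-commutativeSemigroup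
  using () renaming (x∙yz≈y∙xz to *-leftComm)
open import Data.Integer as ℤ using (+_; -[1+_])
import Data.Integer.Properties as ℤ
open import Data.Rational as ℚ using (ℚ; mkℚ; 0ℚ; 1ℚ; _÷_; ∣_∣; _-_; 1/_)
import Data.Rational.Properties as ℚ
open import Data.Rational.Unnormalised as ℚᵘ using (mkℚᵘ)
import Data.Rational.Unnormalised.Properties as ℚᵘ
open import Data.Vec using (Vec; replicate)
open import Data.Product using (∃; _,_)
open import Data.Empty using (⊥-elim)
open import Relation.Nullary using (¬_; yes; no)
open import Relation.Binary.PropositionalEquality

n<2^n : ∀ n → n < 2 ^ n
n<2^n zero    = s≤s z≤n
n<2^n (suc n) =
  ℕ.+-mono-≤ (ℕ.≤-trans (s≤s z≤n) (n<2^n n)) (ℕ.≤-trans (n<2^n n) (ℕ.m≤m+n (2 ^ n) 0))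

i≤+∣i∣ : ∀ i → i ℤ.≤ + ℤ.∣ i ∣
i≤+∣i∣ (+ n)    = ℤ.≤-refl
i≤+∣i∣ -[1+ n ] = ℤ.-≤+

p≤∣p∣ : ∀ p → p ℚ.≤ ∣ p ∣
p≤∣p∣ (mkℚ (+ n) _ _)    = ℚ.≤-refl
p≤∣p∣ (mkℚ -[1+ n ] _ _) = ℚ.*≤* ℤ.-≤+

toℚ : ℕ → ℚ
toℚ c = + c ℚ./ 1

toℚᵘ-toℚ : ∀ c → ℚ.toℚᵘ (toℚ c) ℚᵘ.≃ mkℚᵘ (+ c) 0
toℚᵘ-toℚ c = ℚ.toℚᵘ-fromℚᵘ (mkℚᵘ (+ c) 0)

toℚᵘ-inv : ∀ a → ℚ.toℚᵘ (inv (suc a)) ℚᵘ.≃ mkℚᵘ (+ 1) a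
toℚᵘ-inv a = ℚ.toℚᵘ-fromℚᵘ (mkℚᵘ (+ 1) a)

1≤toℚ-suc : ∀ c → 1ℚ ℚ.≤ toℚ (suc c)
1≤toℚ-suc c = ℚ.toℚᵘ-cancel-≤ (ℚᵘ.≤-respʳ-≃ (ℚᵘ.≃-sym (toℚᵘ-toℚ (suc c)))
  (ℚᵘ.*≤* (subst (+ 1 ℤ.≤_) (sym (ℤ.*-identityʳ (+ suc c))) (ℤ.+≤+ (s≤s z≤n)))))

archimedean-2^ : ∀ p → ∃ λ s → p ℚ.< toℚ (2 ^ s)
archimedean-2^ (mkℚ n d _) = s , ℚ.toℚᵘ-cancel-<
    (ℚᵘ.<-respʳ-≃ (ℚᵘ.≃-sym (toℚᵘ-toℚ (2 ^ s))) (ℚᵘ.*<* n*1<2^s*[1+d]))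
  where
  s = ℤ.∣ n ∣
  n*1<2^s*[1+d] : n ℤ.* + 1 ℤ.< + (2 ^ s) ℤ.* + suc d
  n*1<2^s*[1+d] = begin-strict
    n ℤ.* + 1             ≡⟨ ℤ.*-identityʳ n ⟩
    n                     ≤⟨ i≤+∣i∣ n ⟩
    + s                   <⟨ ℤ.+<+ (ℕ.≤-trans (n<2^n s) (ℕ.m≤m*n (2 ^ s) (suc d))) ⟩
    + (2 ^ s * suc d)     ≡⟨ ℤ.pos-* (2 ^ s) (suc d) ⟩
    + (2 ^ s) ℤ.* + suc d ∎
    where open ℤ.≤-Reasoning

toℚ*inv≤inv : ∀ c a b → 1 ≤ a → 1 ≤ b → c * b ≤ a → toℚ c ℚ.* inv a ℚ.≤ inv b
toℚ*inv≤inv c (suc a) (suc b) _ _ cb≤a = ℚ.toℚᵘ-cancel-≤ (begin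
    ℚ.toℚᵘ (toℚ c ℚ.* inv (suc a))           ≃⟨ ℚ.toℚᵘ-homo-* (toℚ c) (inv (suc a)) ⟩
    ℚ.toℚᵘ (toℚ c) ℚᵘ.* ℚ.toℚᵘ (inv (suc a)) ≃⟨ ℚᵘ.*-cong (toℚᵘ-toℚ c) (toℚᵘ-inv a) ⟩
    mkℚᵘ (+ c) 0 ℚᵘ.* mkℚᵘ (+ 1) a           ≤⟨ ℚᵘ.*≤* (subst₂ ℤ._≤_ lhs rhs (ℤ.+≤+ cb≤a)) ⟩
    mkℚᵘ (+ 1) b                             ≃⟨ ℚᵘ.≃-sym (toℚᵘ-inv b) ⟩
    ℚ.toℚᵘ (inv (suc b))                     ∎)
  where
  open ℚᵘ.≤-Reasoning
  lhs : + (c * suc b) ≡ (+ c ℤ.* + 1) ℤ.* + suc b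
  lhs = trans (ℤ.pos-* c (suc b)) (cong (ℤ._* + suc b) (sym (ℤ.*-identityʳ (+ c))))
  rhs : + suc a ≡ + 1 ℤ.* + suc (a + 0)
  rhs = trans (cong (λ x → + suc x) (sym (ℕ.+-identityʳ a))) (sym (ℤ.*-identityˡ _))

inv-nonNeg : ∀ a → 0ℚ ℚ.≤ inv a
inv-nonNeg zero    = ℚ.≤-refl
inv-nonNeg (suc a) = ℚ.nonNegative⁻¹ _ {{ℚ.normalize-nonNeg 1 (suc a)}}

∣p-1∣<1⇒p<2 : ∀ p → ∣ p - 1ℚ ∣ ℚ.< 1ℚ → p ℚ.< toℚ 2
∣p-1∣<1⇒p<2 p ∣p-1∣<1 = begin-strict
    p                   ≡⟨ sym p-1+1≡p ⟩
    (p - 1ℚ) ℚ.+ 1ℚ     ≤⟨ ℚ.+-monoˡ-≤ 1ℚ (p≤∣p∣ (p - 1ℚ)) ⟩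
    ∣ p - 1ℚ ∣ ℚ.+ 1ℚ   <⟨ ℚ.+-monoˡ-< 1ℚ ∣p-1∣<1 ⟩
    toℚ 2               ∎
  where
  open ℚ.≤-Reasoning
  p-1+1≡p : (p - 1ℚ) ℚ.+ 1ℚ ≡ p
  p-1+1≡p = trans (ℚ.+-assoc p (ℚ.- 1ℚ) 1ℚ)
              (trans (cong (p ℚ.+_) (ℚ.+-inverseˡ 1ℚ)) (ℚ.+-identityʳ p))

÷<⇒<* : ∀ p r x .{{_ : ℚ.Positive x}} → (p ÷ x) {{ℚ.pos⇒nonZero x}} ℚ.< r → p ℚ.< r ℚ.* x
÷<⇒<* p r x p÷x<r = subst (ℚ._< r ℚ.* x) p÷x*x≡p (ℚ.*-monoˡ-<-pos x p÷x<r)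
  where
  instance _ = ℚ.pos⇒nonZero x
  p÷x*x≡p : (p ÷ x) ℚ.* x ≡ p
  p÷x*x≡p = trans (ℚ.*-assoc p (1/ x) x)
              (trans (cong (p ℚ.*_) (ℚ.*-inverseˡ x)) (ℚ.*-identityʳ p))

count÷x-near-1⇒1<2x : ∀ c x .{{_ : ℚ.NonZero x}} → 0ℚ ℚ.≤ x →
  ∣ toℚ c ÷ x - 1ℚ ∣ ℚ.< 1ℚ → 1ℚ ℚ.< toℚ 2 ℚ.* x
count÷x-near-1⇒1<2x zero x _ near =
  ⊥-elim (ℚ.<-irrefl refl (subst (λ y → ∣ y - 1ℚ ∣ ℚ.< 1ℚ) (ℚ.*-zeroˡ (1/ x)) near))
count÷x-near-1⇒1<2x (suc c) x 0≤x near = ℚ.≤-<-trans (1≤toℚ-suc c)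
    (÷<⇒<* (toℚ (suc c)) (toℚ 2) x (∣p-1∣<1⇒p<2 _ near))
  where instance _ = ℚ.nonNeg∧nonZero⇒pos x {{ℚ.nonNegative 0≤x}}

module _ (Q : BasicSeq) where

  2*prodQ≤prodQ-suc : ∀ m j → 2 * prodQ Q m j ≤ prodQ Q (suc m) j
  2*prodQ≤prodQ-suc zero    j = subst (2 ≤_) (sym (ℕ.*-identityʳ (q Q j))) (q≥2 Q j)
  2*prodQ≤prodQ-suc (suc m) j = begin
    2 * (q Q j * P)                  ≡⟨ *-leftComm 2 (q Q j) P ⟩
    q Q j * (2 * P)                  ≤⟨ ℕ.*-monoʳ-≤ (q Q j) (2*prodQ≤prodQ-suc m (suc j)) ⟩
    q Q j * prodQ Q (suc m) (suc j)  ∎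
    where
    open ℕ.≤-Reasoning
    P = prodQ Q m (suc j)

  2^s*prodQ≤prodQ-+ : ∀ s k j → 2 ^ s * prodQ Q k j ≤ prodQ Q (s + k) j
  2^s*prodQ≤prodQ-+ zero    k j = ℕ.≤-reflexive (ℕ.*-identityˡ (prodQ Q k j))
  2^s*prodQ≤prodQ-+ (suc s) k j = begin
    2 * 2 ^ s * prodQ Q k j    ≡⟨ ℕ.*-assoc 2 (2 ^ s) (prodQ Q k j) ⟩
    2 * (2 ^ s * prodQ Q k j)  ≤⟨ ℕ.*-monoʳ-≤ 2 (2^s*prodQ≤prodQ-+ s k j) ⟩
    2 * prodQ Q (s + k) j      ≤⟨ 2*prodQ≤prodQ-suc (s + k) j ⟩
    prodQ Q (suc s + k) j      ∎
    where open ℕ.≤-Reasoning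

  prodQ-positive : ∀ m j → 1 ≤ prodQ Q m j
  prodQ-positive zero    j = s≤s z≤n
  prodQ-positive (suc m) j =
    ℕ.*-mono-≤ (ℕ.≤-trans (s≤s z≤n) (q≥2 Q j)) (prodQ-positive m (suc j))

  Qnk-nonNeg : ∀ m n → 0ℚ ℚ.≤ Qnk Q m n
  Qnk-nonNeg m zero    = ℚ.≤-refl
  Qnk-nonNeg m (suc n) = ℚ.+-mono-≤ (Qnk-nonNeg m n) (inv-nonNeg (prodQ Q m n))

  Qnk-scale : ∀ c k m → (∀ j → c * prodQ Q k j ≤ prodQ Q m j) →
              ∀ n → toℚ c ℚ.* Qnk Q m n ℚ.≤ Qnk Q k n
  Qnk-scale c k m c*Pk≤Pm zero    = ℚ.≤-reflexive (ℚ.*-zeroʳ (toℚ c))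
  Qnk-scale c k m c*Pk≤Pm (suc n) = begin
    toℚ c ℚ.* (Qnk Q m n ℚ.+ inv (prodQ Q m n))
      ≡⟨ ℚ.*-distribˡ-+ (toℚ c) (Qnk Q m n) (inv (prodQ Q m n)) ⟩
    toℚ c ℚ.* Qnk Q m n ℚ.+ toℚ c ℚ.* inv (prodQ Q m n)
      ≤⟨ ℚ.+-mono-≤ (Qnk-scale c k m c*Pk≤Pm n)
           (toℚ*inv≤inv c _ _ (prodQ-positive m n) (prodQ-positive k n) (c*Pk≤Pm n)) ⟩
    Qnk Q k n ℚ.+ inv (prodQ Q k n) ∎
    where open ℚ.≤-Reasoning

  ratio-near-1⇒1<2*Qnk : ∀ E m (B : Vec ℕ m) n →
    ∣ ratio Q E m B n - 1ℚ ∣ ℚ.< 1ℚ → 1ℚ ℚ.< toℚ 2 ℚ.* Qnk Q m n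
  ratio-near-1⇒1<2*Qnk E m B n near with Qnk Q m n ℚ.≟ 0ℚ
  ... | yes _  = ⊥-elim (ℚ.<-irrefl refl near)  -- here ratio is 0 and ∣ 0ℚ - 1ℚ ∣ reduces to 1ℚ
  ... | no Q≢0 = count÷x-near-1⇒1<2x (count E m B n) (Qnk Q m n) {{ℚ.≢-nonZero Q≢0}}
                   (Qnk-nonNeg m n) near

  normalOfOrder⇒1<2*Qnk : ∀ E m → NormalOfOrder Q E m →
    ∃ λ N → ∀ n → N ≤ n → 1ℚ ℚ.< toℚ 2 ℚ.* Qnk Q m n
  normalOfOrder⇒1<2*Qnk E m normal with normal (replicate m 0) 1ℚ (ℚ.positive⁻¹ 1ℚ)
  ... | N , near = N , λ n N≤n → ratio-near-1⇒1<2*Qnk E m _ n (near n N≤n)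

mainTheorem4 : (Q : BasicSeq) (k : ℕ) → 1 ≤ k → KConvergent Q k →
    (E : ℕ → ℕ) → IsExpansion Q E → ¬ Normal Q E
mainTheorem4 Q k _ convergent E _ normal = convergent divergent
  where
  divergent : KDivergent Q k
  divergent M with archimedean-2^ M
  ... | s , M<2^s with normalOfOrder⇒1<2*Qnk Q E (suc (s + k)) (normal _ (s≤s z≤n))
  ... | N , 1<2*Qnk = N , λ n N≤n → begin-strict
      M                        <⟨ M<2^s ⟩
      2^s                      ≡⟨ ℚ.*-identityʳ 2^s ⟨
      2^s ℚ.* 1ℚ               ≤⟨ ℚ.*-monoˡ-≤-nonNeg 2^s {{ℚ.normalize-nonNeg (2 ^ s) 1}}
                                    (1≤Qnk[s+k] n N≤n) ⟩
      2^s ℚ.* Qnk Q (s + k) n  ≤⟨ Qnk-scale Q (2 ^ s) k (s + k) (2^s*prodQ≤prodQ-+ Q s k) n ⟩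
      Qnk Q k n                ∎
    where
    open ℚ.≤-Reasoning
    2^s = toℚ (2 ^ s)
    1≤Qnk[s+k] : ∀ n → N ≤ n → 1ℚ ℚ.≤ Qnk Q (s + k) n
    1≤Qnk[s+k] n N≤n = ℚ.≤-trans (ℚ.<⇒≤ (1<2*Qnk n N≤n))
      (Qnk-scale Q 2 (s + k) _ (2*prodQ≤prodQ-suc Q (s + k)) n)
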